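{- Let $n\geq 3$ and $\pi=\pi_1\cdots\pi_n\in\mathcal{S}_n$. Then [$\pi$ avoids both $213$ and $312$, $\pi^2$ avoids the consecutive pattern $\overline{213}$, and $\pi_1=1$] if and only if $\pi=1\oplus\sigma$ for some $\sigma\in\mathcal{S}_{n-1}$ such that $\sigma$ avoids both $213$ and $312$ and $\sigma^2$ avoids $\overline{213}$.
   Context: $\mathcal{S}_n$ is the set of permutations of $[n]$, written as words with $\pi_i=\pi(i)$; $\pi^2=\pi\circ\pi$. A permutation contains a pattern $\sigma\in\mathcal{S}_k$ if some (not necessarily consecutive) subsequence of length $k$ is order isomorphic to $\sigma$; otherwise it avoids it. A permutation $\pi$ contains the consecutive pattern $\overline{213}$ if there is an index $i$ with $\pi_{i+1}<\pi_i<\pi_{i+2}$; otherwise it avoids it. For $\sigma\in\mathcal{S}_k$, $\tau\in\mathcal{S}_m$, the direct sum $\sigma\oplus\tau\in\mathcal{S}_{k+m}$ is defined by $(\sigma\oplus\tau)(i)=\sigma(i)$ for $1\le i\le k$ and $(\sigma\oplus\tau)(i)=\tau(i-k)+k$ for $k+1\le i\le k+m$. -}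

module Defs where

open import Data.Nat using (ℕ; suc)
open import Data.Fin using (Fin; _<_)
open import Data.Product using (∃-syntax; ∃; _×_)
open import Relation.Nullary using (¬_)
open import Data.Fin.Permutation using (Permutation′; _⟨$⟩ʳ_; _∘ₚ_; lift₀)

sq : ∀ {n} → Permutation′ n → Permutation′ n
sq π = π ∘ₚ π

Contains213 : ∀ {n} → Permutation′ n → Set
Contains213 π = ∃[ i ] ∃[ j ] ∃[ k ]
  (i < j × j < k × (π ⟨$⟩ʳ j) < (π ⟨$⟩ʳ i) × (π ⟨$⟩ʳ i) < (π ⟨$⟩ʳ k))

Contains312 : ∀ {n} → Permutation′ n → Set
Contains312 π = ∃[ i ] ∃[ j ] ∃[ k ]
  (i < j × j < k × (π ⟨$⟩ʳ j) < (π ⟨$⟩ʳ k) × (π ⟨$⟩ʳ k) < (π ⟨$⟩ʳ i))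

Avoids213 : ∀ {n} → Permutation′ n → Set
Avoids213 π = ¬ Contains213 π

Avoids312 : ∀ {n} → Permutation′ n → Set
Avoids312 π = ¬ Contains312 π

-- consecutive pattern 213-bar: positions i, i+1, i+2 with π(i+1) < π(i) < π(i+2).
-- Positions are written via a Fin (suc (suc m)) = Fin n with n = m + 2 as
-- inject / suc of an index i : Fin m.
open import Data.Fin using (inject₁)
ContainsConsec213 : ∀ {m} → Permutation′ (suc (suc m)) → Set
ContainsConsec213 {m} π = ∃ λ (i : Fin m) →
  ((π ⟨$⟩ʳ inject₁ (Data.Fin.suc i)) < (π ⟨$⟩ʳ inject₁ (inject₁ i))
   × (π ⟨$⟩ʳ inject₁ (inject₁ i)) < (π ⟨$⟩ʳ Data.Fin.suc (Data.Fin.suc i)))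

AvoidsConsec213 : ∀ {m} → Permutation′ (suc (suc m)) → Set
AvoidsConsec213 π = ¬ ContainsConsec213 π

oneplus : ∀ {n} → Permutation′ n → Permutation′ (suc n)
oneplus σ = lift₀ σ

-- If π₁ = 1 then π = 1 ⊕ σ, where σ deletes the first entry, and
-- (1 ⊕ σ)² = 1 ⊕ σ².  An occurrence of 213, 312 or 213-bar in 1 ⊕ τ can never
-- use the first entry, since it is smaller than, and to the left of, every
-- other entry; so occurrences in 1 ⊕ τ and in τ correspond by a shift of one.
module Submission where

open import Defs
open import Data.Nat using (ℕ; suc; s≤s)
open import Data.Fin using (zero; suc; _<_)
open import Data.Fin.Permutation
  using (Permutation′; _⟨$⟩ʳ_; _≈_; lift₀; remove; lift₀-comp; lift₀-remove)
open import Data.Product using (∃-syntax; _×_; _,_)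
open import Function.Bundles using (_⇔_; mk⇔; Equivalence)
open import Function.Construct.Composition using (_⇔-∘_)
open import Function.Related.TypeIsomorphisms using (¬-cong-⇔)
open import Relation.Binary.PropositionalEquality using (_≡_; sym; trans; cong; subst₂)

private
  variable
    n : ℕ

≈-sym : (π ρ : Permutation′ n) → π ≈ ρ → ρ ≈ π
≈-sym π ρ π≈ρ i = sym (π≈ρ i)

sq-cong : (π ρ : Permutation′ n) → π ≈ ρ → sq π ≈ sq ρ
sq-cong π ρ π≈ρ i = trans (cong (π ⟨$⟩ʳ_) (π≈ρ i)) (π≈ρ (ρ ⟨$⟩ʳ i))

sq-≈lift₀ : (π : Permutation′ (suc n)) (σ : Permutation′ n) →
  π ≈ lift₀ σ → sq π ≈ lift₀ (sq σ)
sq-≈lift₀ π σ π≈1⊕σ i = trans (sq-cong π (lift₀ σ) π≈1⊕σ i) (lift₀-comp σ σ i)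

Contains213-cong : (π ρ : Permutation′ n) → π ≈ ρ → Contains213 π ⇔ Contains213 ρ
Contains213-cong π ρ π≈ρ = mk⇔ (resp π ρ π≈ρ) (resp ρ π (≈-sym π ρ π≈ρ))
  where
  resp : (π ρ : Permutation′ n) → π ≈ ρ → Contains213 π → Contains213 ρ
  resp π ρ π≈ρ (i , j , k , i<j , j<k , πj<πi , πi<πk) =
    i , j , k , i<j , j<k , subst₂ _<_ (π≈ρ j) (π≈ρ i) πj<πi , subst₂ _<_ (π≈ρ i) (π≈ρ k) πi<πk

Contains312-cong : (π ρ : Permutation′ n) → π ≈ ρ → Contains312 π ⇔ Contains312 ρ
Contains312-cong π ρ π≈ρ = mk⇔ (resp π ρ π≈ρ) (resp ρ π (≈-sym π ρ π≈ρ))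
  where
  resp : (π ρ : Permutation′ n) → π ≈ ρ → Contains312 π → Contains312 ρ
  resp π ρ π≈ρ (i , j , k , i<j , j<k , πj<πk , πk<πi) =
    i , j , k , i<j , j<k , subst₂ _<_ (π≈ρ j) (π≈ρ k) πj<πk , subst₂ _<_ (π≈ρ k) (π≈ρ i) πk<πi

ContainsConsec213-cong : ∀ {m} (π ρ : Permutation′ (suc (suc m))) →
  π ≈ ρ → ContainsConsec213 {m} π ⇔ ContainsConsec213 {m} ρ
ContainsConsec213-cong π ρ π≈ρ = mk⇔ (resp π ρ π≈ρ) (resp ρ π (≈-sym π ρ π≈ρ))
  where
  resp : ∀ {m} (π ρ : Permutation′ (suc (suc m))) →
    π ≈ ρ → ContainsConsec213 {m} π → ContainsConsec213 {m} ρ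
  resp π ρ π≈ρ (i , π₂<π₁ , π₁<π₃) =
    i , subst₂ _<_ (π≈ρ _) (π≈ρ _) π₂<π₁ , subst₂ _<_ (π≈ρ _) (π≈ρ _) π₁<π₃

Contains213-lift₀ : (σ : Permutation′ n) → Contains213 (lift₀ σ) ⇔ Contains213 σ
Contains213-lift₀ σ = mk⇔ drop shift
  where
  drop : Contains213 (lift₀ σ) → Contains213 σ
  drop (zero  , zero  , _     , () , _)
  drop (zero  , suc _ , _     , _  , _  , () , _)
  drop (suc _ , zero  , _     , () , _)
  drop (suc _ , suc _ , zero  , _  , () , _)
  drop (suc i , suc j , suc k , s≤s i<j , s≤s j<k , s≤s σj<σi , s≤s σi<σk) =
    i , j , k , i<j , j<k , σj<σi , σi<σk
  shift : Contains213 σ → Contains213 (lift₀ σ)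
  shift (i , j , k , i<j , j<k , σj<σi , σi<σk) =
    suc i , suc j , suc k , s≤s i<j , s≤s j<k , s≤s σj<σi , s≤s σi<σk

Contains312-lift₀ : (σ : Permutation′ n) → Contains312 (lift₀ σ) ⇔ Contains312 σ
Contains312-lift₀ σ = mk⇔ drop shift
  where
  drop : Contains312 (lift₀ σ) → Contains312 σ
  drop (zero  , zero  , _     , () , _)
  drop (zero  , suc _ , zero  , _  , () , _)
  drop (zero  , suc _ , suc _ , _  , _  , _ , ())
  drop (suc _ , zero  , _     , () , _)
  drop (suc _ , suc _ , zero  , _  , () , _)
  drop (suc i , suc j , suc k , s≤s i<j , s≤s j<k , s≤s σj<σk , s≤s σk<σi) =
    i , j , k , i<j , j<k , σj<σk , σk<σi
  shift : Contains312 σ → Contains312 (lift₀ σ)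
  shift (i , j , k , i<j , j<k , σj<σk , σk<σi) =
    suc i , suc j , suc k , s≤s i<j , s≤s j<k , s≤s σj<σk , s≤s σk<σi

ContainsConsec213-lift₀ : ∀ {m} (τ : Permutation′ (suc (suc m))) →
  ContainsConsec213 {suc m} (lift₀ τ) ⇔ ContainsConsec213 {m} τ
ContainsConsec213-lift₀ τ = mk⇔ drop shift
  where
  drop : ContainsConsec213 (lift₀ τ) → ContainsConsec213 τ
  drop (zero  , () , _)
  drop (suc i , s≤s τ₂<τ₁ , s≤s τ₁<τ₃) = i , τ₂<τ₁ , τ₁<τ₃
  shift : ContainsConsec213 τ → ContainsConsec213 (lift₀ τ)
  shift (i , τ₂<τ₁ , τ₁<τ₃) = suc i , s≤s τ₂<τ₁ , s≤s τ₁<τ₃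

Avoids213-≈lift₀ : (π : Permutation′ (suc n)) (σ : Permutation′ n) →
  π ≈ lift₀ σ → Avoids213 π ⇔ Avoids213 σ
Avoids213-≈lift₀ π σ π≈1⊕σ =
  ¬-cong-⇔ (Contains213-lift₀ σ ⇔-∘ Contains213-cong π (lift₀ σ) π≈1⊕σ)

Avoids312-≈lift₀ : (π : Permutation′ (suc n)) (σ : Permutation′ n) →
  π ≈ lift₀ σ → Avoids312 π ⇔ Avoids312 σ
Avoids312-≈lift₀ π σ π≈1⊕σ =
  ¬-cong-⇔ (Contains312-lift₀ σ ⇔-∘ Contains312-cong π (lift₀ σ) π≈1⊕σ)

AvoidsConsec213-≈lift₀ : ∀ {m} (π : Permutation′ (suc (suc (suc m))))
  (τ : Permutation′ (suc (suc m))) →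
  π ≈ lift₀ τ → AvoidsConsec213 {suc m} π ⇔ AvoidsConsec213 {m} τ
AvoidsConsec213-≈lift₀ π τ π≈1⊕τ =
  ¬-cong-⇔ (ContainsConsec213-lift₀ τ ⇔-∘ ContainsConsec213-cong π (lift₀ τ) π≈1⊕τ)

lemma3p1 : (m : ℕ) (π : Permutation′ (suc (suc (suc m)))) →
    ((Avoids213 π × Avoids312 π × AvoidsConsec213 {suc m} (sq π) × (π ⟨$⟩ʳ zero) ≡ zero)
    ⇔ (∃[ σ ] (π ≈ oneplus σ × Avoids213 σ × Avoids312 σ × AvoidsConsec213 {m} (sq σ))))
lemma3p1 m π = mk⇔ split join
  where
  open Equivalence using (to; from)
  split : Avoids213 π × Avoids312 π × AvoidsConsec213 (sq π) × π ⟨$⟩ʳ zero ≡ zero →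
          ∃[ σ ] (π ≈ lift₀ σ × Avoids213 σ × Avoids312 σ × AvoidsConsec213 (sq σ))
  split (av213 , av312 , avC , π₀≡0) =
    σ , π≈1⊕σ , to (Avoids213-≈lift₀ π σ π≈1⊕σ) av213 , to (Avoids312-≈lift₀ π σ π≈1⊕σ) av312 ,
    to (AvoidsConsec213-≈lift₀ (sq π) (sq σ) (sq-≈lift₀ π σ π≈1⊕σ)) avC
    where
    σ : Permutation′ (suc (suc m))
    σ = remove zero π
    π≈1⊕σ : π ≈ lift₀ σ
    π≈1⊕σ = ≈-sym (lift₀ σ) π (lift₀-remove π π₀≡0)
  join : ∃[ σ ] (π ≈ lift₀ σ × Avoids213 σ × Avoids312 σ × AvoidsConsec213 (sq σ)) →
         Avoids213 π × Avoids312 π × AvoidsConsec213 (sq π) × π ⟨$⟩ʳ zero ≡ zero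
  join (σ , π≈1⊕σ , av213 , av312 , avC) =
    from (Avoids213-≈lift₀ π σ π≈1⊕σ) av213 , from (Avoids312-≈lift₀ π σ π≈1⊕σ) av312 ,
    from (AvoidsConsec213-≈lift₀ (sq π) (sq σ) (sq-≈lift₀ π σ π≈1⊕σ)) avC , π≈1⊕σ zero
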